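{- Let $H=(V,E)$ be a $k$-uniform hypergraph and let $m\geq k$ be an integer. If $H$ does not contain a complete $m$-tuple of missing edges, then every subset $S\subset V$ contains at least $\binom{m}{k}^{ -1}\binom{\frac{1}{k}(|S|-\omega(H))}{k}$ missing edges of $H$ (i.e. at least that many elements of $\binom{V}{k}\setminus E$ are subsets of $S$).
   Context: A $k$-uniform hypergraph $H=(V,E)$ consists of a finite vertex set $V$ and an edge set $E\subset\binom{V}{k}$, where $\binom{S}{k}$ denotes the set of $k$-element subsets of $S$. A set $S\subset V$ is a clique if $\binom{S}{k}\subset E$; $\omega(H)$ is the maximum number of vertices of a clique in $H$. The set of missing edges is $M=\binom{V}{k}\setminus E$. For an integer $m\geq k$, a family $\{\tau_1,\dots,\tau_m\}\subset M$ is a complete $m$-tuple of missing edges if (1) $\tau_i\cap\tau_j=\emptyset$ for all $i\neq j$, and (2) $\{t_1,\dots,t_m\}$ is a clique in $H$ for every choice of $t_i\in\tau_i$, $i\in[m]$. For real $x$, the binomial coefficient is extended as $\binom{x}{k}=\frac{x(x-1)\cdots(x-k+1)}{k!}$ if $x\geq k-1$ and $\binom{x}{k}=0$ if $x<k-1$. -}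

module Defs where

open import Data.Nat as ℕ using (ℕ; zero; suc; _≡ᵇ_; NonZero; _!)
open import Data.Integer as ℤ using (ℤ; +_)
open import Data.Rational as ℚ using (ℚ; _/_; 0ℚ; 1ℚ; _*_; _-_)
open import Data.Rational.Properties using (_≤?_)
open import Data.Bool.ListAction using (and)
open import Data.Bool using (Bool; true; false; if_then_else_)
open import Data.Fin using (Fin)
open import Data.Fin.Subset using (Subset; _∈_; _⊆_; ∣_∣)
open import Data.Vec using (Vec; []; _∷_; map)
open import Data.List as List using (List; []; _∷_; _++_; filter; length)
open import Data.Product using (Σ; _×_; ∃)
open import Data.Empty using (⊥)
open import Relation.Nullary using (¬_; does)
open import Relation.Nullary.Decidable using (_×-dec_)
open import Relation.Binary.PropositionalEquality using (_≡_; _≢_)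
open import Data.Nat.Properties using (_!≢0)
import Data.Fin.Subset.Properties as SP
open import Data.Bool.Properties using () renaming (_≟_ to _≟ᵇ_)

-- k-uniform hypergraphs on the vertex set V = Fin n.
-- The edge set E ⊆ (V choose k) is given by its (Boolean) indicator on
-- subsets; only its values on k-element subsets are relevant.

record Hypergraph (n k : ℕ) : Set where
  field
    edge : Subset n → Bool

open Hypergraph public

Missing : ∀ {n k} → Hypergraph n k → Subset n → Set
Missing {n} {k} H τ = (∣ τ ∣ ≡ k) × (edge H τ ≡ false)

IsCliqueP : ∀ {n k} → Hypergraph n k → (Fin n → Set) → Set
IsCliqueP {n} {k} H P =
  (T : Subset n) → ∣ T ∣ ≡ k → (∀ {v} → v ∈ T → P v) → edge H T ≡ true

IsClique : ∀ {n k} → Hypergraph n k → Subset n → Set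
IsClique H S = IsCliqueP H (λ v → v ∈ S)

allSubsets : (n : ℕ) → List (Subset n)
allSubsets zero    = [] ∷ []
allSubsets (suc n) =
  List.map (false ∷_) (allSubsets n) ++ List.map (true ∷_) (allSubsets n)

isCliqueᵇ : ∀ {n k} → Hypergraph n k → Subset n → Bool
isCliqueᵇ {n} {k} H S =
  and (List.map (λ T → if (∣ T ∣ ≡ᵇ k) then (if does (T SP.⊆? S) then edge H T else true) else true)
           (allSubsets n))

ω : ∀ {n k} → Hypergraph n k → ℕ
ω {n} H = List.foldr ℕ._⊔_ 0
  (List.map ∣_∣ (List.filterᵇ (isCliqueᵇ H) (allSubsets n)))

missingIn : ∀ {n k} → Hypergraph n k → Subset n → ℕ
missingIn {n} {k} H S = length (List.filterᵇ
  (λ T → if (∣ T ∣ ≡ᵇ k) then (if does (T SP.⊆? S) then (if edge H T then false else true) else false) else false)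
  (allSubsets n))

CompleteTuple : ∀ {n k} → Hypergraph n k → (m : ℕ) → (Fin m → Subset n) → Set
CompleteTuple {n} H m τ =
  (∀ i → Missing H (τ i)) ×
  (∀ i j → i ≢ j → ∀ v → v ∈ τ i → v ∈ τ j → ⊥) ×
  ((t : Fin m → Fin n) → (∀ i → t i ∈ τ i) →
     IsCliqueP H (λ v → ∃ λ i → t i ≡ v))

HasCompleteTuple : ∀ {n k} → Hypergraph n k → ℕ → Set
HasCompleteTuple H m = ∃ λ τ → CompleteTuple H m τ

ℕtoℚ : ℕ → ℚ
ℕtoℚ j = (+ j) / 1

fallingℚ : ℚ → ℕ → ℚ
fallingℚ x zero    = 1ℚ
fallingℚ x (suc j) = fallingℚ x j * (x - ℕtoℚ j)

binomℚ : ℚ → ℕ → ℚ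
binomℚ x k =
  if does ((ℕtoℚ k - 1ℚ) ≤? x)
  then fallingℚ x k * _/_ (+ 1) (k !) {{k !≢0}}
  else 0ℚ

-- Reciprocal of a natural number (used only for nonzero arguments).
recipℕ : ℕ → ℚ
recipℕ zero    = 0ℚ
recipℕ (suc c) = (+ 1) / suc c

-- Remove pairwise disjoint missing edges τ₁, …, τᵣ from S greedily until a clique is left, so that
-- ∣S∣ ≤ ω(H) + k r.  For an m-set B of indices the edges τᵢ (i ∈ B) do not form a complete m-tuple,
-- so some transversal of them spans a missing edge T ⊆ S; T meets exactly k of the τᵢ, all indexed
-- by B.  Hence every one of the C(r, m) index sets contains the k-set of indices hit by some missing
-- edge, each such k-set lies in C(r − k, m − k) index sets, and C(r, m) C(m, k) = C(r, k) C(r − k, m − k)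
-- turns this into C(r, k) ≤ C(m, k) · (number of missing edges in S).  Finally (∣S∣ − ω(H))/k ≤ r, and
-- the falling factorial is monotone on [k − 1, ∞), so the extended binomial coefficient is ≤ C(r, k).

module Submission where

module Counting where

  open import Algebra.Properties.CommutativeSemigroup using (interchange)
  open import Data.Bool using (Bool; true; false; _∧_; if_then_else_; T)
  open import Data.Bool.Properties using (∧-zeroʳ) renaming (_≟_ to _≟ᵇ_)
  open import Data.Bool.ListAction using (and)
  open import Data.Empty using (⊥; ⊥-elim)
  open import Data.Fin using (Fin; zero; suc; fromℕ<)
  import Data.Fin.Properties as Finₚ
  open import Data.Fin.Subset
    using (Subset; _∈_; _⊆_; ∣_∣; _─_; _-_; _∩_; outside; inside) renaming (⊥ to ∅)
  open import Data.Fin.Subset.Properties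
    using ( _⊆?_; ⊥⊆; ∣⊥∣≡0; ∣p∣≤n; nonempty?; anySubset?; x∈p∩q⁺; x∈p∩q⁻; x∈p∧x≢y⇒x∈p-y
          ; x∈p⇒∣p-x∣<∣p∣; drop-∷-⊆; p─q⊆p)
  open import Data.List using (List; []; _∷_; _++_; map; foldr; length; filterᵇ)
  open import Data.List.Membership.Propositional using () renaming (_∈_ to _∈ₗ_)
  open import Data.List.Membership.Propositional.Properties using (∈-map⁺; ∈-++⁺ˡ; ∈-++⁺ʳ; ∈-filter⁺)
  open import Data.List.Relation.Unary.Any using (here; there)
  open import Data.Nat
  open import Data.Nat.Properties
  open import Data.Nat.Combinatorics
    using (_C_; nCk+nC[k+1]≡[n+1]C[k+1]; nCk≡n!/k![n-k]!; k![n∸k]!∣n!; k>n⇒nCk≡0)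
  open import Data.Nat.DivMod using (m/n*n≡m)
  open import Data.Nat.Induction using (<-wellFounded)
  open import Data.Nat.Tactic.RingSolver using (solve-∀)
  open import Data.Product using (∃; _×_; _,_; proj₁; proj₂)
  open import Data.Unit using (tt)
  open import Data.Vec using ([]; _∷_; here; there; tabulate)
  open import Data.Vec.Properties using (lookup∘tabulate; []=⇒lookup; lookup⇒[]=)
  open import Function using (_∘_)
  open import Function.Definitions using (Injective)
  open import Induction.WellFounded using (Acc; acc)
  open import Relation.Binary.PropositionalEquality
  open import Relation.Nullary using (¬_; Dec; does; yes; no)
  open import Relation.Nullary.Decidable using (dec-true; dec-false; decidable-stable; _×-dec_; T?)
  open import Defs

  𝟙 : Bool → ℕ
  𝟙 true  = 1
  𝟙 false = 0

  module _ {A : Set} where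

    ∑ : (A → ℕ) → List A → ℕ
    ∑ f []       = 0
    ∑ f (x ∷ xs) = f x + ∑ f xs

    ∑-++ : ∀ f xs ys → ∑ f (xs ++ ys) ≡ ∑ f xs + ∑ f ys
    ∑-++ f []       ys = refl
    ∑-++ f (x ∷ xs) ys = trans (cong (f x +_) (∑-++ f xs ys)) (sym (+-assoc (f x) _ _))

    ∑-cong : ∀ {f g} → (∀ x → f x ≡ g x) → ∀ xs → ∑ f xs ≡ ∑ g xs
    ∑-cong f≗g []       = refl
    ∑-cong f≗g (x ∷ xs) = cong₂ _+_ (f≗g x) (∑-cong f≗g xs)

    ∑-mono : ∀ {f g} → (∀ x → f x ≤ g x) → ∀ xs → ∑ f xs ≤ ∑ g xs
    ∑-mono f≤g []       = z≤n
    ∑-mono f≤g (x ∷ xs) = +-mono-≤ (f≤g x) (∑-mono f≤g xs)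

    ∑-zero : ∀ {f} → (∀ x → f x ≡ 0) → ∀ xs → ∑ f xs ≡ 0
    ∑-zero f≗0 []       = refl
    ∑-zero f≗0 (x ∷ xs) = cong₂ _+_ (f≗0 x) (∑-zero f≗0 xs)

    ∑-+ : ∀ f g xs → ∑ (λ x → f x + g x) xs ≡ ∑ f xs + ∑ g xs
    ∑-+ f g []       = refl
    ∑-+ f g (x ∷ xs) =
      trans (cong (f x + g x +_) (∑-+ f g xs)) (interchange +-commutativeSemigroup (f x) (g x) _ _)

    ∑-*ʳ : ∀ c f xs → ∑ (λ x → f x * c) xs ≡ ∑ f xs * c
    ∑-*ʳ c f []       = refl
    ∑-*ʳ c f (x ∷ xs) = trans (cong (f x * c +_) (∑-*ʳ c f xs)) (sym (*-distribʳ-+ c (f x) _))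

    ∑-𝟙 : ∀ p xs → ∑ (𝟙 ∘ p) xs ≡ length (filterᵇ p xs)
    ∑-𝟙 p []       = refl
    ∑-𝟙 p (x ∷ xs) with p x
    ... | true  = cong suc (∑-𝟙 p xs)
    ... | false = ∑-𝟙 p xs

    ∑-∈ : ∀ f {x xs} → x ∈ₗ xs → f x ≤ ∑ f xs
    ∑-∈ f {xs = y ∷ ys} (here refl) = m≤m+n (f y) _
    ∑-∈ f {xs = y ∷ ys} (there x∈ys) = ≤-trans (∑-∈ f x∈ys) (m≤n+m _ (f y))

  ∑-map : ∀ {A B : Set} (f : B → ℕ) (g : A → B) xs → ∑ f (map g xs) ≡ ∑ (f ∘ g) xs
  ∑-map f g []       = refl
  ∑-map f g (x ∷ xs) = cong (f (g x) +_) (∑-map f g xs)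

  ∑-swap : ∀ {A B : Set} (F : A → B → ℕ) xs ys →
           ∑ (λ y → ∑ (λ x → F x y) xs) ys ≡ ∑ (λ x → ∑ (F x) ys) xs
  ∑-swap F xs []       = sym (∑-zero (λ _ → refl) xs)
  ∑-swap F xs (y ∷ ys) =
    trans (cong (∑ (λ x → F x y) xs +_) (∑-swap F xs ys))
          (sym (∑-+ (λ x → F x y) (λ x → ∑ (F x) ys) xs))

  ≤-foldr-⊔ : ∀ {x xs} → x ∈ₗ xs → x ≤ foldr _⊔_ 0 xs
  ≤-foldr-⊔ {xs = y ∷ ys} (here refl) = m≤m⊔n y _
  ≤-foldr-⊔ {xs = y ∷ ys} (there x∈ys) = m≤n⇒m≤o⊔n y (≤-foldr-⊔ x∈ys)

  and-map-true : ∀ {A : Set} {f : A → Bool} → (∀ x → f x ≡ true) → ∀ xs → and (map f xs) ≡ true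
  and-map-true f≡true []       = refl
  and-map-true f≡true (x ∷ xs) rewrite f≡true x = and-map-true f≡true xs

  -- Binomial coefficients

  nCk≤[n+1]C[k+1] : ∀ n k → n C k ≤ suc n C suc k
  nCk≤[n+1]C[k+1] n k = subst (n C k ≤_) (nCk+nC[k+1]≡[n+1]C[k+1] n k) (m≤m+n _ _)

  nCk≤[d+n]C[d+k] : ∀ d n k → n C k ≤ (d + n) C (d + k)
  nCk≤[d+n]C[d+k] zero    n k = ≤-refl
  nCk≤[d+n]C[d+k] (suc d) n k = ≤-trans (nCk≤[d+n]C[d+k] d n k) (nCk≤[n+1]C[k+1] (d + n) (d + k))

  nCk≤[n+1]Ck : ∀ n k → n C k ≤ suc n C k
  nCk≤[n+1]Ck n zero    = ≤-refl
  nCk≤[n+1]Ck n (suc k) = subst (n C suc k ≤_) (nCk+nC[k+1]≡[n+1]C[k+1] n k) (m≤n+m _ _)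

  nCk≤mCk : ∀ {n m} k → n ≤′ m → n C k ≤ m C k
  nCk≤mCk k ≤′-refl        = ≤-refl
  nCk≤mCk k (≤′-step n≤′m) = ≤-trans (nCk≤mCk k n≤′m) (nCk≤[n+1]Ck _ k)

  nCk*k![n∸k]!≡n! : ∀ {n k} → k ≤ n → (n C k) * (k ! * (n ∸ k) !) ≡ n !
  nCk*k![n∸k]!≡n! {n} {k} k≤n =
    trans (cong (_* (k ! * (n ∸ k) !)) (nCk≡n!/k![n-k]! k≤n)) (m/n*n≡m (k![n∸k]!∣n! k≤n))
    where instance _ = k !* (n ∸ k) !≢0

  0<nCk : ∀ {n k} → k ≤ n → 0 < n C k
  0<nCk {n} {k} k≤n = n≢0⇒n>0 λ nCk≡0 →
    ≢-nonZero⁻¹ (n !) {{n !≢0}}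
      (trans (sym (nCk*k![n∸k]!≡n! k≤n)) (cong (_* (k ! * (n ∸ k) !)) nCk≡0))

  -- Multiplied by k! (m ∸ k)! (n ∸ m)!, both sides become n!.
  nCk*[n∸k]C[m∸k]≡mCk*nCm : ∀ {n m k} → k ≤ m → m ≤ n →
                            (n C k) * ((n ∸ k) C (m ∸ k)) ≡ (m C k) * (n C m)
  nCk*[n∸k]C[m∸k]≡mCk*nCm {n} {m} {k} k≤m m≤n = *-cancelʳ-≡ _ _ (a * (b * c)) (begin
    (n C k) * D * (a * (b * c))                       ≡⟨ regroup₁ (n C k) D a b c ⟩
    (n C k) * (a * (D * (b * c)))                     ≡⟨ cong (λ j → (n C k) * (a * (D * (b * j !))))
                                                              [n∸k]∸[m∸k]≡n∸m ⟨
    (n C k) * (a * (D * (b * ((n ∸ k) ∸ (m ∸ k)) !))) ≡⟨ cong (λ j → (n C k) * (a * j))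
                                                              (nCk*k![n∸k]!≡n! (∸-monoˡ-≤ k m≤n)) ⟩
    (n C k) * (a * (n ∸ k) !)                         ≡⟨ nCk*k![n∸k]!≡n! (≤-trans k≤m m≤n) ⟩
    n !                                               ≡⟨ nCk*k![n∸k]!≡n! m≤n ⟨
    (n C m) * (m ! * c)                               ≡⟨ cong (λ j → (n C m) * (j * c)) (nCk*k![n∸k]!≡n! k≤m) ⟨
    (n C m) * ((m C k) * (a * b) * c)                 ≡⟨ regroup₂ (n C m) (m C k) a b c ⟩
    (m C k) * (n C m) * (a * (b * c))                 ∎)
    where
    open ≡-Reasoning
    a = k !
    b = (m ∸ k) !
    c = (n ∸ m) !
    D = (n ∸ k) C (m ∸ k)
    instance _ = m*n≢0 a (b * c) {{k !≢0}} {{(m ∸ k) !* (n ∸ m) !≢0}}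
    [n∸k]∸[m∸k]≡n∸m : (n ∸ k) ∸ (m ∸ k) ≡ n ∸ m
    [n∸k]∸[m∸k]≡n∸m = trans (∸-+-assoc n k (m ∸ k)) (cong (n ∸_) (m+[n∸m]≡n k≤m))
    regroup₁ : ∀ w x y z t → w * x * (y * (z * t)) ≡ w * (y * (x * (z * t)))
    regroup₁ = solve-∀
    regroup₂ : ∀ w x y z t → w * (x * (y * z) * t) ≡ x * w * (y * (z * t))
    regroup₂ = solve-∀

  rCk≤mCk*N : ∀ {r m k N} → 1 ≤ k → k ≤ m →
              (m ≤ r → r C m ≤ N * ((r ∸ k) C (m ∸ k))) → (1 ≤ r → 1 ≤ N) →
              r C k ≤ (m C k) * N
  rCk≤mCk*N {r} {m} {k} {N} 1≤k k≤m count nonempty with m ≤? r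
  ... | yes m≤r = *-cancelʳ-≤ (r C k) ((m C k) * N) D {{>-nonZero (0<nCk (∸-monoˡ-≤ k m≤r))}} (begin
    (r C k) * D        ≡⟨ nCk*[n∸k]C[m∸k]≡mCk*nCm k≤m m≤r ⟩
    (m C k) * (r C m)  ≤⟨ *-monoʳ-≤ (m C k) (count m≤r) ⟩
    (m C k) * (N * D)  ≡⟨ *-assoc (m C k) N D ⟨
    (m C k) * N * D    ∎)
    where
    open ≤-Reasoning
    D = (r ∸ k) C (m ∸ k)
  ... | no m≰r with r
  ...   | zero   = ≤-trans (≤-reflexive (k>n⇒nCk≡0 1≤k)) z≤n
  ...   | suc r′ = ≤-trans (nCk≤mCk k (≤⇒≤′ (<⇒≤ (≰⇒> m≰r))))
                     (m≤m*n (m C k) N {{>-nonZero (nonempty (s≤s z≤n))}})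

  ∑ₛ : ∀ n → (Subset n → ℕ) → ℕ
  ∑ₛ n f = ∑ f (allSubsets n)

  ∑ₛ-suc : ∀ n f → ∑ₛ (suc n) f ≡ ∑ₛ n (f ∘ (outside ∷_)) + ∑ₛ n (f ∘ (inside ∷_))
  ∑ₛ-suc n f = trans (∑-++ f (map (outside ∷_) (allSubsets n)) _)
    (cong₂ _+_ (∑-map f (outside ∷_) (allSubsets n)) (∑-map f (inside ∷_) (allSubsets n)))

  ∈-allSubsets : ∀ {n} (p : Subset n) → p ∈ₗ allSubsets n
  ∈-allSubsets []            = here refl
  ∈-allSubsets (outside ∷ p) = ∈-++⁺ˡ (∈-map⁺ (outside ∷_) (∈-allSubsets p))
  ∈-allSubsets (inside ∷ p)  = ∈-++⁺ʳ _ (∈-map⁺ (inside ∷_) (∈-allSubsets p))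

  ∣p─q∣+∣q∣≡∣p∣ : ∀ {n} {p q : Subset n} → q ⊆ p → ∣ p ─ q ∣ + ∣ q ∣ ≡ ∣ p ∣
  ∣p─q∣+∣q∣≡∣p∣ {p = []}          {[]}          _   = refl
  ∣p─q∣+∣q∣≡∣p∣ {p = outside ∷ p} {outside ∷ q} q⊆p = ∣p─q∣+∣q∣≡∣p∣ (drop-∷-⊆ q⊆p)
  ∣p─q∣+∣q∣≡∣p∣ {p = inside ∷ p}  {outside ∷ q} q⊆p = cong suc (∣p─q∣+∣q∣≡∣p∣ (drop-∷-⊆ q⊆p))
  ∣p─q∣+∣q∣≡∣p∣ {p = s ∷ p}       {inside ∷ q}  q⊆p with q⊆p here
  ... | here = trans (+-suc _ _) (cong suc (∣p─q∣+∣q∣≡∣p∣ (drop-∷-⊆ q⊆p)))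

  x∈p─q⇒x∉q : ∀ {n} {p q : Subset n} {x} → x ∈ p ─ q → x ∈ q → ⊥
  x∈p─q⇒x∉q {p = inside ∷ p} {outside ∷ q} here      ()
  x∈p─q⇒x∉q {p = _ ∷ p}      {_ ∷ q}       (there x∈p─q) (there x∈q) = x∈p─q⇒x∉q x∈p─q x∈q

  ∣p∣≤∣q∣-injection : ∀ {n r} {p : Subset n} {q : Subset r} (f : ∀ {x} → x ∈ p → Fin r) →
                      (∀ {x} (x∈p : x ∈ p) → f x∈p ∈ q) →
                      (∀ {x y} (x∈p : x ∈ p) (y∈p : y ∈ p) → f x∈p ≡ f y∈p → x ≡ y) →
                      ∣ p ∣ ≤ ∣ q ∣
  ∣p∣≤∣q∣-injection {p = []} f f∈q f-inj = z≤n
  ∣p∣≤∣q∣-injection {p = outside ∷ p} f f∈q f-inj =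
    ∣p∣≤∣q∣-injection (f ∘ there) (f∈q ∘ there)
                      (λ x∈p y∈p → Finₚ.suc-injective ∘ f-inj (there x∈p) (there y∈p))
  ∣p∣≤∣q∣-injection {p = inside ∷ p} {q} f f∈q f-inj = begin-strict
    ∣ p ∣             ≤⟨ ∣p∣≤∣q∣-injection (f ∘ there) f′∈q-f₀ f′-inj ⟩
    ∣ (q - f here) ∣  <⟨ x∈p⇒∣p-x∣<∣p∣ (f∈q here) ⟩
    ∣ q ∣             ∎
    where
    open ≤-Reasoning
    f′∈q-f₀ : ∀ {x} (x∈p : x ∈ p) → f (there x∈p) ∈ q - f here
    f′∈q-f₀ x∈p =
      x∈p∧x≢y⇒x∈p-y (f∈q (there x∈p)) (λ eq → Finₚ.0≢1+n (sym (f-inj (there x∈p) here eq)))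
    f′-inj : ∀ {x y} (x∈p : x ∈ p) (y∈p : y ∈ p) → f (there x∈p) ≡ f (there y∈p) → x ≡ y
    f′-inj x∈p y∈p = Finₚ.suc-injective ∘ f-inj (there x∈p) (there y∈p)

  hits : ∀ {n r} → (Fin r → Subset n) → Subset n → Subset r
  hits τ T = tabulate (λ i → does (nonempty? (T ∩ τ i)))

  module _ {n r} {τ : Fin r → Subset n} {T : Subset n} where

    ∈-hits⁺ : ∀ {i v} → v ∈ T → v ∈ τ i → i ∈ hits τ T
    ∈-hits⁺ {i} {v} v∈T v∈τi = lookup⇒[]= i (hits τ T)
      (trans (lookup∘tabulate _ i) (dec-true (nonempty? (T ∩ τ i)) (v , x∈p∩q⁺ (v∈T , v∈τi))))

    ∈-hits⁻ : ∀ {i} → i ∈ hits τ T → ∃ λ v → v ∈ T × v ∈ τ i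
    ∈-hits⁻ {i} i∈hits
      with nonempty? (T ∩ τ i) | trans (sym (lookup∘tabulate _ i)) ([]=⇒lookup i∈hits)
    ... | yes (v , v∈T∩τi) | _ = v , x∈p∩q⁻ T (τ i) v∈T∩τi

  enumerate : ∀ {r} (B : Subset r) →
              ∃ λ (e : Fin ∣ B ∣ → Fin r) → (∀ j → e j ∈ B) × Injective _≡_ _≡_ e
  enumerate []            = (λ ()) , (λ ()) , λ { {()} }
  enumerate (outside ∷ B) with enumerate B
  ... | e , e∈B , e-inj = suc ∘ e , there ∘ e∈B , e-inj ∘ Finₚ.suc-injective
  enumerate (inside ∷ B)  with enumerate B
  ... | e , e∈B , e-inj = e′ , e′∈B , e′-inj
    where
    e′ : Fin (suc ∣ B ∣) → Fin _
    e′ zero    = zero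
    e′ (suc j) = suc (e j)
    e′∈B : ∀ j → e′ j ∈ inside ∷ B
    e′∈B zero    = here
    e′∈B (suc j) = there (e∈B j)
    e′-inj : Injective _≡_ _≡_ e′
    e′-inj {zero}  {zero}  _  = refl
    e′-inj {suc i} {suc j} eq = cong suc (e-inj (Finₚ.suc-injective eq))

  -- Counting supersets

  supersets : ∀ {r} → Subset r → ℕ → ℕ
  supersets {r} A m = ∑ₛ r (λ B → 𝟙 (does (A ⊆? B) ∧ does (∣ B ∣ ≟ m)))

  module _ {r} (A : Subset r) where

    ∑ₛ-𝟙-∧-false : ∑ₛ r (λ B → 𝟙 (does (A ⊆? B) ∧ false)) ≡ 0
    ∑ₛ-𝟙-∧-false = ∑-zero (λ B → cong 𝟙 (∧-zeroʳ (does (A ⊆? B)))) (allSubsets r)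

    supersets-outside-zero : supersets (outside ∷ A) 0 ≡ supersets A 0
    supersets-outside-zero = trans (∑ₛ-suc r _) (trans (cong (supersets A 0 +_) ∑ₛ-𝟙-∧-false) (+-identityʳ _))

    supersets-outside-suc : ∀ m → supersets (outside ∷ A) (suc m) ≡ supersets A (suc m) + supersets A m
    supersets-outside-suc m = ∑ₛ-suc r _

    supersets-inside-zero : supersets (inside ∷ A) 0 ≡ 0
    supersets-inside-zero = trans (∑ₛ-suc r _) (cong₂ _+_ (∑-zero (λ _ → refl) (allSubsets r)) ∑ₛ-𝟙-∧-false)

    supersets-inside-suc : ∀ m → supersets (inside ∷ A) (suc m) ≡ supersets A m
    supersets-inside-suc m =
      trans (∑ₛ-suc r _) (cong (_+ supersets A m) (∑-zero (λ _ → refl) (allSubsets r)))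

  supersets-≡0 : ∀ {r} (A : Subset r) m → m < ∣ A ∣ → supersets A m ≡ 0
  supersets-≡0 (outside ∷ A) zero    m<a       = trans (supersets-outside-zero A) (supersets-≡0 A 0 m<a)
  supersets-≡0 (outside ∷ A) (suc m) m<a       = trans (supersets-outside-suc A m)
    (cong₂ _+_ (supersets-≡0 A (suc m) m<a) (supersets-≡0 A m (<-trans (n<1+n m) m<a)))
  supersets-≡0 (inside ∷ A)  zero    _         = supersets-inside-zero A
  supersets-≡0 (inside ∷ A)  (suc m) (s≤s m<a) = trans (supersets-inside-suc A m) (supersets-≡0 A m m<a)

  supersets-≡C : ∀ {r} (A : Subset r) m → ∣ A ∣ ≤ m → supersets A m ≡ (r ∸ ∣ A ∣) C (m ∸ ∣ A ∣)
  supersets-≡C []            zero    _   = refl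
  supersets-≡C []            (suc m) _   = refl
  supersets-≡C (outside ∷ A) zero    a≤0 with ∣ A ∣ | n≤0⇒n≡0 a≤0 | supersets-≡C A 0 a≤0
  ... | .0 | refl | ih = trans (supersets-outside-zero A) ih
  supersets-≡C {suc r} (outside ∷ A) (suc m) a≤1+m with ∣ A ∣ ≤? m
  ... | yes a≤m = begin
    supersets (outside ∷ A) (suc m)
      ≡⟨ supersets-outside-suc A m ⟩
    supersets A (suc m) + supersets A m
      ≡⟨ cong₂ _+_ (supersets-≡C A (suc m) a≤1+m) (supersets-≡C A m a≤m) ⟩
    (r ∸ a) C (suc m ∸ a) + (r ∸ a) C (m ∸ a)
      ≡⟨ cong (λ j → (r ∸ a) C j + (r ∸ a) C (m ∸ a)) (+-∸-assoc 1 a≤m) ⟩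
    (r ∸ a) C suc (m ∸ a) + (r ∸ a) C (m ∸ a)
      ≡⟨ +-comm ((r ∸ a) C suc (m ∸ a)) _ ⟩
    (r ∸ a) C (m ∸ a) + (r ∸ a) C suc (m ∸ a)
      ≡⟨ nCk+nC[k+1]≡[n+1]C[k+1] (r ∸ a) (m ∸ a) ⟩
    suc (r ∸ a) C suc (m ∸ a)
      ≡⟨ sym (cong₂ _C_ (+-∸-assoc 1 (∣p∣≤n A)) (+-∸-assoc 1 a≤m)) ⟩
    (suc r ∸ a) C (suc m ∸ a) ∎
    where
    open ≡-Reasoning
    a = ∣ A ∣
  ... | no a≰m = begin
    supersets (outside ∷ A) (suc m)
      ≡⟨ supersets-outside-suc A m ⟩
    supersets A (suc m) + supersets A m
      ≡⟨ cong₂ _+_ (supersets-≡C A (suc m) a≤1+m) (supersets-≡0 A m (≰⇒> a≰m)) ⟩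
    (r ∸ a) C (suc m ∸ a) + 0
      ≡⟨ +-identityʳ _ ⟩
    (r ∸ a) C (suc m ∸ a)
      ≡⟨ cong ((r ∸ a) C_) 1+m∸a≡0 ⟩
    (r ∸ a) C 0
      ≡⟨ cong ((suc r ∸ a) C_) 1+m∸a≡0 ⟨
    (suc r ∸ a) C (suc m ∸ a) ∎
    where
    open ≡-Reasoning
    a = ∣ A ∣
    1+m∸a≡0 : suc m ∸ a ≡ 0
    1+m∸a≡0 = m≤n⇒m∸n≡0 (≰⇒> a≰m)
  supersets-≡C (inside ∷ A)  (suc m) (s≤s a≤m) =
    trans (supersets-inside-suc A m) (supersets-≡C A m a≤m)

  supersets-≤ : ∀ {r} (A : Subset r) m {k} → k ≤ ∣ A ∣ → supersets A m ≤ (r ∸ k) C (m ∸ k)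
  supersets-≤ {r} A m {k} k≤a with ∣ A ∣ ≤? m
  ... | no a≰m  = ≤-trans (≤-reflexive (supersets-≡0 A m (≰⇒> a≰m))) z≤n
  ... | yes a≤m = begin
    supersets A m                                  ≡⟨ supersets-≡C A m a≤m ⟩
    (r ∸ a) C (m ∸ a)                              ≤⟨ nCk≤[d+n]C[d+k] (a ∸ k) (r ∸ a) (m ∸ a) ⟩
    ((a ∸ k) + (r ∸ a)) C ((a ∸ k) + (m ∸ a))      ≡⟨ cong₂ _C_ (split (∣p∣≤n A)) (split a≤m) ⟩
    (r ∸ k) C (m ∸ k)                              ∎
    where
    open ≤-Reasoning
    a = ∣ A ∣
    split : ∀ {j} → a ≤ j → (a ∸ k) + (j ∸ a) ≡ j ∸ k
    split {j} a≤j = trans (sym (+-∸-comm (j ∸ a) k≤a)) (cong (_∸ k) (m+[n∸m]≡n a≤j))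

  count-subsets-of-size : ∀ r m → ∑ₛ r (λ B → 𝟙 (does (∣ B ∣ ≟ m))) ≡ r C m
  count-subsets-of-size r m = begin
    ∑ₛ r (λ B → 𝟙 (does (∣ B ∣ ≟ m)))
      ≡⟨ ∑-cong (λ B → cong (λ b → 𝟙 (b ∧ does (∣ B ∣ ≟ m))) (dec-true (∅ ⊆? B) ⊥⊆))
                (allSubsets r) ⟨
    supersets (∅ {r}) m
      ≡⟨ supersets-≡C (∅ {r}) m (subst (_≤ m) (sym (∣⊥∣≡0 r)) z≤n) ⟩
    (r ∸ ∣ ∅ {r} ∣) C (m ∸ ∣ ∅ {r} ∣)
      ≡⟨ cong (λ a → (r ∸ a) C (m ∸ a)) (∣⊥∣≡0 r) ⟩
    r C m ∎
    where
    open ≡-Reasoning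

  module _ {X : Set} {r} (xs : List X) (w : X → Bool) (A : X → Subset r) (k m : ℕ) where

    covering-bound :
      (∀ B → ∣ B ∣ ≡ m → ∃ λ x → x ∈ₗ xs × w x ≡ true × k ≤ ∣ A x ∣ × A x ⊆ B) →
      r C m ≤ length (filterᵇ w xs) * ((r ∸ k) C (m ∸ k))
    covering-bound cover = begin
      r C m                              ≡⟨ count-subsets-of-size r m ⟨
      ∑ₛ r (λ B → 𝟙 (does (∣ B ∣ ≟ m)))  ≤⟨ ∑-mono covered (allSubsets r) ⟩
      ∑ₛ r (λ B → ∑ (λ x → F x B) xs)    ≡⟨ ∑-swap F xs (allSubsets r) ⟩
      ∑ (λ x → ∑ₛ r (F x)) xs            ≤⟨ ∑-mono contained xs ⟩
      ∑ (λ x → 𝟙 (w x) * D) xs           ≡⟨ ∑-*ʳ D (𝟙 ∘ w) xs ⟩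
      ∑ (𝟙 ∘ w) xs * D                   ≡⟨ cong (_* D) (∑-𝟙 w xs) ⟩
      length (filterᵇ w xs) * D          ∎
      where
      open ≤-Reasoning
      D = (r ∸ k) C (m ∸ k)
      F : X → Subset r → ℕ
      F x B = 𝟙 (w x ∧ does (k ≤? ∣ A x ∣) ∧ does (A x ⊆? B) ∧ does (∣ B ∣ ≟ m))

      covered : ∀ B → 𝟙 (does (∣ B ∣ ≟ m)) ≤ ∑ (λ x → F x B) xs
      covered B with ∣ B ∣ ≟ m
      ... | no ∣B∣≢m = ≤-trans (≤-reflexive (cong 𝟙 (dec-false (∣ B ∣ ≟ m) ∣B∣≢m))) z≤n
      ... | yes ∣B∣≡m with cover B ∣B∣≡m
      ...   | x , x∈xs , wx , k≤∣Ax∣ , Ax⊆B = begin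
        𝟙 (does (∣ B ∣ ≟ m))  ≡⟨ cong 𝟙 (dec-true (∣ B ∣ ≟ m) ∣B∣≡m) ⟩
        1                     ≡⟨ Fx≡1 ⟨
        F x B                 ≤⟨ ∑-∈ (λ x → F x B) x∈xs ⟩
        ∑ (λ x → F x B) xs    ∎
        where
        Fx≡1 : F x B ≡ 1
        Fx≡1 = cong 𝟙 (cong₂ _∧_ wx (cong₂ _∧_ (dec-true (k ≤? ∣ A x ∣) k≤∣Ax∣)
                 (cong₂ _∧_ (dec-true (A x ⊆? B) Ax⊆B) (dec-true (∣ B ∣ ≟ m) ∣B∣≡m))))

      contained : ∀ x → ∑ₛ r (F x) ≤ 𝟙 (w x) * D
      contained x with w x | k ≤? ∣ A x ∣
      ... | false | _         = ≤-reflexive (∑-zero (λ _ → refl) (allSubsets r))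
      ... | true  | no k≰∣Ax∣ = ≤-trans (≤-reflexive (∑-zero
              (λ B → cong (λ b → 𝟙 (b ∧ _)) (dec-false (k ≤? ∣ A x ∣) k≰∣Ax∣))
              (allSubsets r))) z≤n
      ... | true  | yes k≤∣Ax∣ = begin
        ∑ₛ r (λ B → 𝟙 (does (k ≤? ∣ A x ∣) ∧ does (A x ⊆? B) ∧ does (∣ B ∣ ≟ m)))
          ≡⟨ ∑-cong (λ B → cong (λ b → 𝟙 (b ∧ _)) (dec-true (k ≤? ∣ A x ∣) k≤∣Ax∣))
                    (allSubsets r) ⟩
        supersets (A x) m
          ≤⟨ supersets-≤ (A x) m k≤∣Ax∣ ⟩
        D
          ≡⟨ +-identityʳ D ⟨
        1 * D ∎

  -- Cliques and packings of missing edges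

  module _ {n k} (H : Hypergraph n k) where

    clique⇒≤ω : ∀ {R} → IsClique H R → ∣ R ∣ ≤ ω H
    clique⇒≤ω {R} R-clique =
      ≤-foldr-⊔ (∈-map⁺ ∣_∣ (∈-filter⁺ (T? ∘ isCliqueᵇ H) (∈-allSubsets R) isClique))
      where
      test : ∀ E → (if (∣ E ∣ ≡ᵇ k) then (if does (E ⊆? R) then edge H E else true) else true) ≡ true
      test E with ∣ E ∣ ≡ᵇ k in ∣E∣≡ᵇk | E ⊆? R
      ... | true  | yes E⊆R = R-clique E (≡ᵇ⇒≡ ∣ E ∣ k (subst T (sym ∣E∣≡ᵇk) tt)) E⊆R
      ... | true  | no _    = refl
      ... | false | _       = refl
      isClique : T (isCliqueᵇ H R)
      isClique = subst T (sym (and-map-true test (allSubsets n))) tt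

    -- Spelled exactly as the test in missingIn, so that missingIn H S unfolds to
    -- length (filterᵇ (isMissingInᵇ S) (allSubsets n)).
    isMissingInᵇ : Subset n → Subset n → Bool
    isMissingInᵇ S T =
      if (∣ T ∣ ≡ᵇ k) then (if does (T ⊆? S) then (if edge H T then false else true) else false) else false

    isMissingInᵇ-true : ∀ {S T} → Missing H T → T ⊆ S → isMissingInᵇ S T ≡ true
    isMissingInᵇ-true {S} {T} (∣T∣≡k , T∉E) T⊆S
      rewrite dec-true (∣ T ∣ ≟ k) ∣T∣≡k | dec-true (T ⊆? S) T⊆S | T∉E = refl

    1≤missingIn : ∀ {S T} → Missing H T → T ⊆ S → 1 ≤ missingIn H S
    1≤missingIn {S} {T} T-missing T⊆S = begin
      1                                         ≡⟨ cong 𝟙 (isMissingInᵇ-true T-missing T⊆S) ⟨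
      𝟙 (isMissingInᵇ S T)                      ≤⟨ ∑-∈ (𝟙 ∘ isMissingInᵇ S) (∈-allSubsets T) ⟩
      ∑ (𝟙 ∘ isMissingInᵇ S) (allSubsets n)     ≡⟨ ∑-𝟙 (isMissingInᵇ S) (allSubsets n) ⟩
      missingIn H S                             ∎
      where open ≤-Reasoning

  PairwiseDisjoint : ∀ {n r} → (Fin r → Subset n) → Set
  PairwiseDisjoint τ = ∀ i j → i ≢ j → ∀ v → v ∈ τ i → v ∈ τ j → ⊥

  record MissingPacking {n k} (H : Hypergraph n k) (R : Subset n) : Set where
    field
      size       : ℕ
      edges      : Fin size → Subset n
      missing    : ∀ i → Missing H (edges i)
      within     : ∀ i → edges i ⊆ R
      disjoint   : PairwiseDisjoint edges
      size-bound : ∣ R ∣ ≤ ω H + k * size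

  module _ {n k} (H : Hypergraph n k) where

    clique-packing : ∀ {R} → IsClique H R → MissingPacking H R
    clique-packing {R} R-clique = record
      { size = 0 ; edges = λ () ; missing = λ () ; within = λ () ; disjoint = λ ()
      ; size-bound = subst (∣ R ∣ ≤_) (sym (trans (cong (ω H +_) (*-zeroʳ k)) (+-identityʳ (ω H))))
                           (clique⇒≤ω H R-clique)
      }

    extend-packing : ∀ {R T} → Missing H T → T ⊆ R → MissingPacking H (R ─ T) → MissingPacking H R
    extend-packing {R} {T} T-missing T⊆R P = record
      { size = suc size ; edges = edges′ ; missing = missing′ ; within = within′ ; disjoint = disjoint′
      ; size-bound = begin
          ∣ R ∣                  ≡⟨ ∣p─q∣+∣q∣≡∣p∣ T⊆R ⟨
          ∣ R ─ T ∣ + ∣ T ∣      ≡⟨ cong (∣ R ─ T ∣ +_) (proj₁ T-missing) ⟩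
          ∣ R ─ T ∣ + k          ≤⟨ +-monoˡ-≤ k size-bound ⟩
          ω H + k * size + k     ≡⟨ +-assoc (ω H) (k * size) k ⟩
          ω H + (k * size + k)   ≡⟨ cong (ω H +_) (trans (*-suc k size) (+-comm k (k * size))) ⟨
          ω H + k * suc size     ∎
      }
      where
      open MissingPacking P
      open ≤-Reasoning
      edges′ : Fin (suc size) → Subset n
      edges′ zero    = T
      edges′ (suc i) = edges i
      missing′ : ∀ i → Missing H (edges′ i)
      missing′ zero    = T-missing
      missing′ (suc i) = missing i
      within′ : ∀ i → edges′ i ⊆ R
      within′ zero    = T⊆R
      within′ (suc i) = p─q⊆p R T ∘ within i
      disjoint′ : PairwiseDisjoint edges′
      disjoint′ zero    zero    0≢0 = ⊥-elim (0≢0 refl)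
      disjoint′ zero    (suc j) _   v v∈T v∈j = x∈p─q⇒x∉q (within j v∈j) v∈T
      disjoint′ (suc i) zero    _   v v∈i v∈T = x∈p─q⇒x∉q (within i v∈i) v∈T
      disjoint′ (suc i) (suc j) i≢j = disjoint i j (i≢j ∘ cong suc)

    missing? : ∀ T → Dec (Missing H T)
    missing? T = (∣ T ∣ ≟ k) ×-dec (edge H T ≟ᵇ false)

    missingPacking : .{{NonZero k}} → ∀ R → MissingPacking H R
    missingPacking R = go R (<-wellFounded ∣ R ∣)
      where
      go : ∀ R → Acc _<_ ∣ R ∣ → MissingPacking H R
      go R (acc rec) with anySubset? (λ T → missing? T ×-dec T ⊆? R)
      ... | yes (T , T-missing , T⊆R) = extend-packing T-missing T⊆R (go (R ─ T) (rec ∣R─T∣<∣R∣))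
        where
        ∣R─T∣<∣R∣ : ∣ R ─ T ∣ < ∣ R ∣
        ∣R─T∣<∣R∣ = begin-strict
          ∣ R ─ T ∣          <⟨ m<m+n ∣ R ─ T ∣ (>-nonZero⁻¹ k) ⟩
          ∣ R ─ T ∣ + k      ≡⟨ cong (∣ R ─ T ∣ +_) (proj₁ T-missing) ⟨
          ∣ R ─ T ∣ + ∣ T ∣  ≡⟨ ∣p─q∣+∣q∣≡∣p∣ T⊆R ⟩
          ∣ R ∣              ∎
          where open ≤-Reasoning
      ... | no no-missing = clique-packing R-clique
        where
        R-clique : IsClique H R
        R-clique T ∣T∣≡k T⊆R with edge H T in T-edge
        ... | true  = refl
        ... | false = ⊥-elim (no-missing (T , (∣T∣≡k , T-edge) , T⊆R))

  module _ {n k} {H : Hypergraph n k} {S : Subset n} (P : MissingPacking H S) where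
    open MissingPacking P

    disjoint⇒same-edge : ∀ {i j v} → v ∈ edges i → v ∈ edges j → i ≡ j
    disjoint⇒same-edge {i} {j} {v} v∈i v∈j with i Finₚ.≟ j
    ... | yes i≡j = i≡j
    ... | no  i≢j = ⊥-elim (disjoint i j i≢j v v∈i v∈j)

    Hit : Subset size → Subset n → Set
    Hit B T = Missing H T × T ⊆ S × k ≤ ∣ hits edges T ∣ × hits edges T ⊆ B

    ¬hit⇒complete-tuple : ∀ B → ¬ (∃ λ T → Hit B T) → HasCompleteTuple H ∣ B ∣
    ¬hit⇒complete-tuple B no-hit = edges ∘ e , missing ∘ e , disjoint-e , complete
      where
      e = proj₁ (enumerate B)
      e∈B = proj₁ (proj₂ (enumerate B))
      e-inj = proj₂ (proj₂ (enumerate B))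

      disjoint-e : PairwiseDisjoint (edges ∘ e)
      disjoint-e i j i≢j = disjoint (e i) (e j) (i≢j ∘ e-inj)

      complete : (t : Fin ∣ B ∣ → Fin n) → (∀ j → t j ∈ edges (e j)) →
                 IsCliqueP H (λ v → ∃ λ j → t j ≡ v)
      complete t t∈e T ∣T∣≡k T⊆t with edge H T in T-edge
      ... | true  = refl
      ... | false = ⊥-elim (no-hit (T , (∣T∣≡k , T-edge) , T⊆S , k≤∣hits∣ , hits⊆B))
        where
        located : ∀ {v} → v ∈ T → ∃ λ j → v ∈ edges (e j)
        located v∈T with T⊆t v∈T
        ... | j , refl = j , t∈e j

        T⊆S : T ⊆ S
        T⊆S v∈T = within _ (proj₂ (located v∈T))

        -- Each vertex of T is some t j ∈ edges (e j), and distinct vertices come from distinct j.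
        k≤∣hits∣ : k ≤ ∣ hits edges T ∣
        k≤∣hits∣ = subst (_≤ ∣ hits edges T ∣) ∣T∣≡k (∣p∣≤∣q∣-injection
          (e ∘ proj₁ ∘ located) (λ v∈T → ∈-hits⁺ v∈T (proj₂ (located v∈T))) index-inj)
          where
          index-inj : ∀ {v w} (v∈T : v ∈ T) (w∈T : w ∈ T) →
                      e (proj₁ (located v∈T)) ≡ e (proj₁ (located w∈T)) → v ≡ w
          index-inj v∈T w∈T eq with T⊆t v∈T | T⊆t w∈T
          ... | j , refl | j′ , refl = cong t (e-inj eq)

        hits⊆B : hits edges T ⊆ B
        hits⊆B i∈hits with ∈-hits⁻ i∈hits
        ... | v , v∈T , v∈i with located v∈T
        ...   | j , v∈j = subst (_∈ B) (disjoint⇒same-edge v∈j v∈i) (e∈B j)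

    hit? : ∀ B T → Dec (Hit B T)
    hit? B T = missing? H T ×-dec T ⊆? S ×-dec k ≤? ∣ hits edges T ∣ ×-dec hits edges T ⊆? B

    no-complete-tuple⇒hit : ∀ {m} → ¬ HasCompleteTuple H m → ∀ B → ∣ B ∣ ≡ m → ∃ λ T → Hit B T
    no-complete-tuple⇒hit no-tuple B refl =
      decidable-stable (anySubset? (hit? B)) (no-tuple ∘ ¬hit⇒complete-tuple B)

  missing-edges-bound : ∀ {n k m} .{{_ : NonZero k}} (H : Hypergraph n k) → k ≤ m →
                        ¬ HasCompleteTuple H m → (S : Subset n) →
                        ∃ λ r → ∣ S ∣ ≤ ω H + k * r × r C k ≤ (m C k) * missingIn H S
  missing-edges-bound {n} {k} {m} H k≤m no-tuple S =
    size , size-bound , rCk≤mCk*N (>-nonZero⁻¹ k) k≤m (λ _ → covered) nonempty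
    where
    P = missingPacking H S
    open MissingPacking P

    covered : size C m ≤ missingIn H S * ((size ∸ k) C (m ∸ k))
    covered = covering-bound (allSubsets n) (isMissingInᵇ H S) (hits edges) k m λ B ∣B∣≡m →
      let T , T-missing , T⊆S , k≤∣hits∣ , hits⊆B = no-complete-tuple⇒hit P no-tuple B ∣B∣≡m
      in T , ∈-allSubsets T , isMissingInᵇ-true H T-missing T⊆S , k≤∣hits∣ , hits⊆B

    nonempty : 1 ≤ size → 1 ≤ missingIn H S
    nonempty 1≤size = 1≤missingIn H (missing i₀) (within i₀)
      where i₀ = fromℕ< 1≤size

module RationalBounds where

  open import Data.Bool using (if_then_else_)
  open import Data.Integer as ℤ using (+_; _⊖_)
  import Data.Integer.Properties as ℤₚ
  open import Data.Nat as ℕ using (zero; suc; NonZero; _!; z≤n)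
  import Data.Nat.Properties as ℕₚ
  open import Data.Nat.Combinatorics using (_C_; nCk≡nPk/k!; k>n⇒nCk≡0)
  open import Data.Nat.Combinatorics.Base using (_P′_; _P_)
  open import Data.Nat.Combinatorics.Specification using (k!∣nP′k; nPk≡n!/[n∸k]!; nP′k≡n!/[n∸k]!)
  open import Data.Nat.DivMod using (m/n*n≡m)
  open import Data.Product using (_×_; _,_; proj₂)
  open import Data.Rational using (_≤_; _*_; _/_; _+_; _-_; -_; 0ℚ; 1ℚ; toℚᵘ; nonNegative)
  open import Data.Rational.Properties
  import Data.Rational.Unnormalised as ℚᵘ
  import Data.Rational.Unnormalised.Properties as ℚᵘₚ
  open import Relation.Binary.PropositionalEquality
  open import Relation.Nullary using (Dec; does; yes; no)
  open import Defs using (ℕtoℚ; fallingℚ; binomℚ; recipℕ)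

  ℕtoℚ-toℚᵘ : ∀ a → toℚᵘ (ℕtoℚ a) ℚᵘ.≃ ℚᵘ.mkℚᵘ (+ a) 0
  ℕtoℚ-toℚᵘ a = toℚᵘ-fromℚᵘ (ℚᵘ.mkℚᵘ (+ a) 0)

  ℕtoℚ-homo-* : ∀ a b → ℕtoℚ (a ℕ.* b) ≡ ℕtoℚ a * ℕtoℚ b
  ℕtoℚ-homo-* a b = toℚᵘ-injective (begin
    toℚᵘ (ℕtoℚ (a ℕ.* b))                  ≈⟨ ℕtoℚ-toℚᵘ (a ℕ.* b) ⟩
    ℚᵘ.mkℚᵘ (+ (a ℕ.* b)) 0                ≈⟨ ℚᵘ.*≡* (cong (ℤ._* + 1) (ℤₚ.pos-* a b)) ⟩
    ℚᵘ.mkℚᵘ (+ a) 0 ℚᵘ.* ℚᵘ.mkℚᵘ (+ b) 0   ≈⟨ ℚᵘₚ.*-cong (ℕtoℚ-toℚᵘ a) (ℕtoℚ-toℚᵘ b) ⟨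
    toℚᵘ (ℕtoℚ a) ℚᵘ.* toℚᵘ (ℕtoℚ b)       ≈⟨ toℚᵘ-homo-* (ℕtoℚ a) (ℕtoℚ b) ⟨
    toℚᵘ (ℕtoℚ a * ℕtoℚ b)                 ∎)
    where open ℚᵘₚ.≃-Reasoning

  ℕtoℚ-homo-+ : ∀ a b → ℕtoℚ (a ℕ.+ b) ≡ ℕtoℚ a + ℕtoℚ b
  ℕtoℚ-homo-+ a b = toℚᵘ-injective (begin
    toℚᵘ (ℕtoℚ (a ℕ.+ b))                  ≈⟨ ℕtoℚ-toℚᵘ (a ℕ.+ b) ⟩
    ℚᵘ.mkℚᵘ (+ (a ℕ.+ b)) 0                ≈⟨ ℚᵘ.*≡* (cong (ℤ._* + 1) (trans (ℤₚ.pos-+ a b)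
                                                (sym (cong₂ ℤ._+_ (ℤₚ.*-identityʳ (+ a)) (ℤₚ.*-identityʳ (+ b)))))) ⟩
    ℚᵘ.mkℚᵘ (+ a) 0 ℚᵘ.+ ℚᵘ.mkℚᵘ (+ b) 0   ≈⟨ ℚᵘₚ.+-cong (ℕtoℚ-toℚᵘ a) (ℕtoℚ-toℚᵘ b) ⟨
    toℚᵘ (ℕtoℚ a) ℚᵘ.+ toℚᵘ (ℕtoℚ b)       ≈⟨ toℚᵘ-homo-+ (ℕtoℚ a) (ℕtoℚ b) ⟨
    toℚᵘ (ℕtoℚ a + ℕtoℚ b)                 ∎)
    where open ℚᵘₚ.≃-Reasoning

  ℕtoℚ-mono-≤ : ∀ {a b} → a ℕ.≤ b → ℕtoℚ a ≤ ℕtoℚ b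
  ℕtoℚ-mono-≤ {a} {b} a≤b = toℚᵘ-cancel-≤
    (ℚᵘₚ.≤-respʳ-≃ (ℚᵘₚ.≃-sym (ℕtoℚ-toℚᵘ b)) (ℚᵘₚ.≤-respˡ-≃ (ℚᵘₚ.≃-sym (ℕtoℚ-toℚᵘ a))
      (ℚᵘ.*≤* (subst₂ ℤ._≤_ (sym (ℤₚ.*-identityʳ (+ a))) (sym (ℤₚ.*-identityʳ (+ b))) (ℤ.+≤+ a≤b)))))

  ℕtoℚ-homo-∸ : ∀ {a b} → b ℕ.≤ a → ℕtoℚ (a ℕ.∸ b) ≡ ℕtoℚ a - ℕtoℚ b
  ℕtoℚ-homo-∸ {a} {b} b≤a = begin
    ℕtoℚ (a ℕ.∸ b)                        ≡⟨ +-identityʳ _ ⟨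
    ℕtoℚ (a ℕ.∸ b) + 0ℚ                   ≡⟨ cong (λ q → ℕtoℚ (a ℕ.∸ b) + q) (+-inverseʳ (ℕtoℚ b)) ⟨
    ℕtoℚ (a ℕ.∸ b) + (ℕtoℚ b - ℕtoℚ b)    ≡⟨ +-assoc (ℕtoℚ (a ℕ.∸ b)) (ℕtoℚ b) (- ℕtoℚ b) ⟨
    (ℕtoℚ (a ℕ.∸ b) + ℕtoℚ b) - ℕtoℚ b    ≡⟨ cong (_- ℕtoℚ b) (ℕtoℚ-homo-+ (a ℕ.∸ b) b) ⟨
    ℕtoℚ (a ℕ.∸ b ℕ.+ b) - ℕtoℚ b         ≡⟨ cong (λ c → ℕtoℚ c - ℕtoℚ b) (ℕₚ.m∸n+n≡m b≤a) ⟩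
    ℕtoℚ a - ℕtoℚ b                       ∎
    where open ≡-Reasoning

  ℕtoℚ*1/ℕ : ∀ d .{{_ : NonZero d}} → ℕtoℚ d * ((+ 1) / d) ≡ 1ℚ
  ℕtoℚ*1/ℕ (suc c) = toℚᵘ-injective (ℚᵘₚ.≃-trans (toℚᵘ-homo-* (ℕtoℚ (suc c)) ((+ 1) / suc c))
    (ℚᵘₚ.≃-trans (ℚᵘₚ.*-cong (ℕtoℚ-toℚᵘ (suc c)) (toℚᵘ-fromℚᵘ (ℚᵘ.mkℚᵘ (+ 1) c)))
      (ℚᵘₚ.≃-trans (ℚᵘ.*≡* eq) (ℚᵘₚ.≃-sym (toℚᵘ-fromℚᵘ (ℚᵘ.mkℚᵘ (+ 1) 0))))))
    where
    eq : (+ suc c ℤ.* + 1) ℤ.* + 1 ≡ + 1 ℤ.* + suc (c ℕ.+ 0)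
    eq = trans (ℤₚ.*-identityʳ _) (trans (ℤₚ.*-identityʳ _)
           (sym (trans (ℤₚ.*-identityˡ _) (cong (λ z → + suc z) (ℕₚ.+-identityʳ c)))))

  nP′k≡0 : ∀ {n k} → n ℕ.< k → n P′ k ≡ 0
  nP′k≡0 {n} {suc k} (ℕ.s≤s n≤k) with n ℕ.≟ k
  ... | yes refl = cong (ℕ._* (n P′ n)) (ℕₚ.n∸n≡0 n)
  ... | no  n≢k  =
    trans (cong ((n ℕ.∸ k) ℕ.*_) (nP′k≡0 (ℕₚ.≤∧≢⇒< n≤k n≢k))) (ℕₚ.*-zeroʳ (n ℕ.∸ k))

  nCk*k!≡nP′k : ∀ n k → (n C k) ℕ.* k ! ≡ n P′ k
  nCk*k!≡nP′k n k with k ℕ.≤? n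
  ... | no k≰n  = trans (cong (ℕ._* k !) (k>n⇒nCk≡0 (ℕₚ.≰⇒> k≰n))) (sym (nP′k≡0 (ℕₚ.≰⇒> k≰n)))
  ... | yes k≤n = begin
    (n C k) ℕ.* k !             ≡⟨ cong (ℕ._* k !) (nCk≡nPk/k! k≤n) ⟩
    ((n P k) ℕ./ k !) ℕ.* k !   ≡⟨ cong (λ p → (p ℕ./ k !) ℕ.* k !)
                                        (trans (nPk≡n!/[n∸k]! k≤n) (sym (nP′k≡n!/[n∸k]! k≤n))) ⟩
    ((n P′ k) ℕ./ k !) ℕ.* k !  ≡⟨ m/n*n≡m (k!∣nP′k k≤n) ⟩
    n P′ k                      ∎
    where
    open ≡-Reasoning
    instance _ = k ℕₚ.!≢0

  fallingℚ-ℕtoℚ : ∀ r j → fallingℚ (ℕtoℚ r) j ≡ ℕtoℚ (r P′ j)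
  fallingℚ-ℕtoℚ r zero    = refl
  fallingℚ-ℕtoℚ r (suc j) with j ℕ.≤? r
  ... | yes j≤r = begin
    fallingℚ (ℕtoℚ r) j * (ℕtoℚ r - ℕtoℚ j)   ≡⟨ cong₂ _*_ (fallingℚ-ℕtoℚ r j) (sym (ℕtoℚ-homo-∸ j≤r)) ⟩
    ℕtoℚ (r P′ j) * ℕtoℚ (r ℕ.∸ j)            ≡⟨ ℕtoℚ-homo-* (r P′ j) (r ℕ.∸ j) ⟨
    ℕtoℚ ((r P′ j) ℕ.* (r ℕ.∸ j))             ≡⟨ cong ℕtoℚ (ℕₚ.*-comm (r P′ j) (r ℕ.∸ j)) ⟩
    ℕtoℚ (r P′ suc j)                         ∎
    where open ≡-Reasoning
  ... | no j≰r = begin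
    fallingℚ (ℕtoℚ r) j * (ℕtoℚ r - ℕtoℚ j)   ≡⟨ cong (_* (ℕtoℚ r - ℕtoℚ j))
                                                      (trans (fallingℚ-ℕtoℚ r j) (cong ℕtoℚ (nP′k≡0 r<j))) ⟩
    0ℚ * (ℕtoℚ r - ℕtoℚ j)                    ≡⟨ *-zeroˡ (ℕtoℚ r - ℕtoℚ j) ⟩
    0ℚ                                        ≡⟨ cong ℕtoℚ (nP′k≡0 (ℕₚ.m<n⇒m<1+n r<j)) ⟨
    ℕtoℚ (r P′ suc j)                         ∎
    where
    open ≡-Reasoning
    r<j = ℕₚ.≰⇒> j≰r

  *-mono-≤-nonNeg : ∀ {a b c d} → 0ℚ ≤ a → a ≤ b → 0ℚ ≤ c → c ≤ d → a * c ≤ b * d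
  *-mono-≤-nonNeg {a} {b} {c} {d} 0≤a a≤b 0≤c c≤d =
    ≤-trans (*-monoʳ-≤-nonNeg c {{nonNegative 0≤c}} a≤b)
            (*-monoˡ-≤-nonNeg b {{nonNegative (≤-trans 0≤a a≤b)}} c≤d)

  fallingℚ-mono-≤ : ∀ {x y} j → x ≤ y → (∀ i → i ℕ.< j → ℕtoℚ i ≤ x) →
                    0ℚ ≤ fallingℚ x j × fallingℚ x j ≤ fallingℚ y j
  fallingℚ-mono-≤         zero    x≤y i≤x = ℕtoℚ-mono-≤ {0} {1} z≤n , ≤-refl
  fallingℚ-mono-≤ {x} {y} (suc j) x≤y i≤x
    with fallingℚ-mono-≤ j x≤y (λ i i<j → i≤x i (ℕₚ.m<n⇒m<1+n i<j))
  ... | 0≤Fx , Fx≤Fy = *-mono-≤-nonNeg ≤-refl 0≤Fx ≤-refl 0≤x-j ,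
                       *-mono-≤-nonNeg 0≤Fx Fx≤Fy 0≤x-j (+-monoˡ-≤ (- ℕtoℚ j) x≤y)
    where
    0≤x-j : 0ℚ ≤ x - ℕtoℚ j
    0≤x-j = subst (_≤ x - ℕtoℚ j) (+-inverseʳ (ℕtoℚ j)) (+-monoˡ-≤ (- ℕtoℚ j) (i≤x j (ℕₚ.n<1+n j)))

  binomℚ≤nCk : ∀ {x} r k → x ≤ ℕtoℚ r → binomℚ x k ≤ ℕtoℚ (r C k)
  binomℚ≤nCk {x} r k x≤r = if-does-≤ ((ℕtoℚ k - 1ℚ) ≤? x) bound (ℕtoℚ-mono-≤ {0} {r C k} z≤n)
    where
    if-does-≤ : ∀ {P : Set} {a c} (P? : Dec P) → (P → a ≤ c) → 0ℚ ≤ c →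
                (if does P? then a else 0ℚ) ≤ c
    if-does-≤ (yes p) a≤c _   = a≤c p
    if-does-≤ (no _)  _   0≤c = 0≤c

    1/k! = ((+ 1) / k !) {{k ℕₚ.!≢0}}

    bound : ℕtoℚ k - 1ℚ ≤ x → fallingℚ x k * 1/k! ≤ ℕtoℚ (r C k)
    bound k-1≤x = begin
      fallingℚ x k * 1/k!                  ≤⟨ *-monoʳ-≤-nonNeg 1/k! {{normalize-nonNeg 1 (k !) {{k ℕₚ.!≢0}}}}
                                                (proj₂ (fallingℚ-mono-≤ k x≤r i≤x)) ⟩
      fallingℚ (ℕtoℚ r) k * 1/k!           ≡⟨ cong (_* 1/k!) (trans (fallingℚ-ℕtoℚ r k)
                                                                    (cong ℕtoℚ (sym (nCk*k!≡nP′k r k)))) ⟩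
      ℕtoℚ ((r C k) ℕ.* k !) * 1/k!        ≡⟨ cong (_* 1/k!) (ℕtoℚ-homo-* (r C k) (k !)) ⟩
      ℕtoℚ (r C k) * ℕtoℚ (k !) * 1/k!     ≡⟨ *-assoc (ℕtoℚ (r C k)) (ℕtoℚ (k !)) 1/k! ⟩
      ℕtoℚ (r C k) * (ℕtoℚ (k !) * 1/k!)   ≡⟨ cong (ℕtoℚ (r C k) *_) (ℕtoℚ*1/ℕ (k !) {{k ℕₚ.!≢0}}) ⟩
      ℕtoℚ (r C k) * 1ℚ                    ≡⟨ *-identityʳ (ℕtoℚ (r C k)) ⟩
      ℕtoℚ (r C k)                         ∎
      where
      open ≤-Reasoning
      i≤x : ∀ i → i ℕ.< k → ℕtoℚ i ≤ x
      i≤x i i<k = ≤-trans (subst (_≤ ℕtoℚ k - 1ℚ) (sym (ℕtoℚ-homo-∸ {suc i} {1} (ℕ.s≤s z≤n)))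
                            (+-monoˡ-≤ (- 1ℚ) (ℕtoℚ-mono-≤ i<k))) k-1≤x

  [a-b]/k≤r : ∀ {a b r} k .{{_ : NonZero k}} → a ℕ.≤ b ℕ.+ k ℕ.* r → (+ a ℤ.- + b) / k ≤ ℕtoℚ r
  [a-b]/k≤r {a} {b} {r} (suc k′) a≤b+kr = toℚᵘ-cancel-≤ (ℚᵘₚ.≤-respʳ-≃ (ℚᵘₚ.≃-sym (ℕtoℚ-toℚᵘ r))
    (ℚᵘₚ.≤-respˡ-≃ (ℚᵘₚ.≃-sym (toℚᵘ-fromℚᵘ (ℚᵘ.mkℚᵘ (+ a ℤ.- + b) k′))) (ℚᵘ.*≤* cross)))
    where
    lhs : (+ a ℤ.- + b) ℤ.* + 1 ≡ a ⊖ b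
    lhs = trans (ℤₚ.*-identityʳ _) (ℤₚ.m-n≡m⊖n a b)
    rhs : + r ℤ.* + suc k′ ≡ + (suc k′ ℕ.* r)
    rhs = trans (sym (ℤₚ.pos-* r (suc k′))) (cong +_ (ℕₚ.*-comm r (suc k′)))
    cross : (+ a ℤ.- + b) ℤ.* + 1 ℤ.≤ + r ℤ.* + suc k′
    cross with b ℕ.≤? a
    ... | yes b≤a = subst₂ ℤ._≤_ (sym (trans lhs (ℤₚ.⊖-≥ b≤a))) (sym rhs)
                      (ℤ.+≤+ (ℕₚ.m≤n+o⇒m∸n≤o a b a≤b+kr))
    ... | no  b≰a = subst₂ ℤ._≤_ (sym (trans lhs (ℤₚ.⊖-< (ℕₚ.≰⇒> b≰a)))) (sym rhs) ℤₚ.neg-≤-pos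

  recipℕ*-≤ : ∀ {c N y} → 0 ℕ.< c → y ≤ ℕtoℚ (c ℕ.* N) → recipℕ c * y ≤ ℕtoℚ N
  recipℕ*-≤ {suc c} {N} {y} _ y≤cN = begin
    ρ * y                           ≤⟨ *-monoˡ-≤-nonNeg ρ {{normalize-nonNeg 1 (suc c)}} y≤cN ⟩
    ρ * ℕtoℚ (suc c ℕ.* N)          ≡⟨ cong (ρ *_) (ℕtoℚ-homo-* (suc c) N) ⟩
    ρ * (ℕtoℚ (suc c) * ℕtoℚ N)     ≡⟨ *-assoc ρ (ℕtoℚ (suc c)) (ℕtoℚ N) ⟨
    ρ * ℕtoℚ (suc c) * ℕtoℚ N       ≡⟨ cong (_* ℕtoℚ N)
                                            (trans (*-comm ρ (ℕtoℚ (suc c))) (ℕtoℚ*1/ℕ (suc c))) ⟩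
    1ℚ * ℕtoℚ N                     ≡⟨ *-identityˡ (ℕtoℚ N) ⟩
    ℕtoℚ N                          ∎
    where
    open ≤-Reasoning
    ρ = recipℕ (suc c)

open import Defs
open import Data.Nat using (ℕ; _≥_; NonZero)
open import Data.Nat.Combinatorics using (_C_)
open import Data.Integer using (+_; _-_)
open import Data.Rational using (_≤_; _*_; _/_)
open import Data.Fin.Subset using (Subset; ∣_∣)
open import Relation.Nullary using (¬_)
open import Data.Product using (_,_)
open import Data.Rational.Properties using (≤-trans)
open Counting using (0<nCk; missing-edges-bound)
open RationalBounds using (ℕtoℚ-mono-≤; binomℚ≤nCk; [a-b]/k≤r; recipℕ*-≤)

lemma1 : (n k m : ℕ) → .{{_ : NonZero k}} → (H : Hypergraph n k) → m ≥ k →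
         ¬ HasCompleteTuple H m → (S : Subset n) →
         recipℕ (m C k) * binomℚ ((+ ∣ S ∣ - + ω H) / k) k ≤ ℕtoℚ (missingIn H S)
lemma1 n k m H k≤m no-tuple S =
  let r , ∣S∣≤ω+kr , rCk≤mCk*miss = missing-edges-bound H k≤m no-tuple S
  in recipℕ*-≤ (0<nCk k≤m)
       (≤-trans (binomℚ≤nCk r k ([a-b]/k≤r k ∣S∣≤ω+kr)) (ℕtoℚ-mono-≤ rCk≤mCk*miss))
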